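{- There is a sequence $(\varphi_n)_{n\in\mathbb N}$ of $\mu\mathrm{ML}$-formulae of size polynomial in $n$ such that, over words, each $\varphi_n$ is equivalent to some $\mathrm{ML}$-formula, but every $\psi\in\mathrm{ML}$ equivalent to $\varphi_n$ over words has size at least $2^n$.
   Context: Fix a finite set of propositions and a single action. $\mathrm{ML}$ is basic modal logic (formulae from $\top,\bot$, propositions and negated propositions, $\wedge,\vee$, $\Diamond,\Box$), $\mu\mathrm{ML}$ is the modal $\mu$-calculus. Words (finite or infinite) are tree models in which every point has at most one successor; two formulae are equivalent over words if exactly the same words satisfy them (at the first position). Size of a formula is the number of nodes of its syntax tree. -}

module Defs where

open import Data.Nat using (ℕ; zero; suc; _+_; _*_; _^_; _≤_; _<_)
open import Data.Fin using (Fin; zero; suc)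
open import Data.Bool using (Bool; true; false)
open import Data.Maybe using (Maybe; just; nothing)
open import Data.Unit using (⊤)
open import Data.Empty using (⊥)
open import Data.Sum using (_⊎_)
open import Data.Product using (Σ; _×_; _,_)
open import Relation.Binary.PropositionalEquality using (_≡_)
open import Relation.Nullary using (¬_)

-- Propositions: Fin k (a fixed finite set of k propositions); single action.
-- μML formulae in negation normal form, de Bruijn variables; Formula k n has
-- n free fixpoint variables.
data Formula (k : ℕ) : ℕ → Set where
  tt ff    : ∀ {n} → Formula k n
  prop     : ∀ {n} → Fin k → Formula k n
  nprop    : ∀ {n} → Fin k → Formula k n
  var      : ∀ {n} → Fin n → Formula k n
  _∧_ _∨_  : ∀ {n} → Formula k n → Formula k n → Formula k n
  ◇ □      : ∀ {n} → Formula k n → Formula k n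
  μ ν      : ∀ {n} → Formula k (suc n) → Formula k n

data IsML {k : ℕ} {n : ℕ} : Formula k n → Set where
  tt    : IsML tt
  ff    : IsML ff
  prop  : ∀ p → IsML (prop p)
  nprop : ∀ p → IsML (nprop p)
  _∧_   : ∀ {φ ψ} → IsML φ → IsML ψ → IsML (φ ∧ ψ)
  _∨_   : ∀ {φ ψ} → IsML φ → IsML ψ → IsML (φ ∨ ψ)
  ◇     : ∀ {φ} → IsML φ → IsML (◇ φ)
  □     : ∀ {φ} → IsML φ → IsML (□ φ)

size : ∀ {k n} → Formula k n → ℕ
size tt = 1
size ff = 1
size (prop _) = 1
size (nprop _) = 1
size (var _) = 1
size (φ ∧ ψ) = suc (size φ + size ψ)
size (φ ∨ ψ) = suc (size φ + size ψ)
size (◇ φ) = suc (size φ)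
size (□ φ) = suc (size φ)
size (μ φ) = suc (size φ)
size (ν φ) = suc (size φ)

-- Words: positions 0,1,2,...; len = nothing: infinite word;
-- len = just m: finite word with positions 0..m (so words are non-empty).
-- label i p: whether proposition p holds at position i (ignored beyond the end).
record Word (k : ℕ) : Set where
  field
    len   : Maybe ℕ
    label : ℕ → Fin k → Bool
open Word public

HasSucc : ∀ {k} → Word k → ℕ → Set
HasSucc w i with len w
... | nothing = ⊤
... | just m  = suc i ≤ m

Pred : Set₁
Pred = ℕ → Set

-- Candidate sets of positions for fixpoints are ℕ → Bool (classically: all subsets).
asPred : (ℕ → Bool) → Pred
asPred X i = X i ≡ true

extend : ∀ {n} → (Fin n → Pred) → Pred → Fin (suc n) → Pred
extend ρ P zero = P
extend ρ P (suc x) = ρ x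

-- Knaster–Tarski semantics: μ = intersection of prefixed points,
-- ν = union of postfixed points.
sem : ∀ {k n} → Word k → Formula k n → (Fin n → Pred) → Pred
sem w tt ρ i = ⊤
sem w ff ρ i = ⊥
sem w (prop p) ρ i = label w i p ≡ true
sem w (nprop p) ρ i = label w i p ≡ false
sem w (var x) ρ i = ρ x i
sem w (φ ∧ ψ) ρ i = sem w φ ρ i × sem w ψ ρ i
sem w (φ ∨ ψ) ρ i = sem w φ ρ i ⊎ sem w ψ ρ i
sem w (◇ φ) ρ i = HasSucc w i × sem w φ ρ (suc i)
sem w (□ φ) ρ i = HasSucc w i → sem w φ ρ (suc i)
sem w (μ φ) ρ i =
  (X : ℕ → Bool) → (∀ j → sem w φ (extend ρ (asPred X)) j → asPred X j) → asPred X i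
sem w (ν φ) ρ i =
  Σ (ℕ → Bool) λ X → (∀ j → asPred X j → sem w φ (extend ρ (asPred X)) j) × asPred X i

empty : Fin 0 → Pred
empty ()

_⊨_ : ∀ {k} → Word k → Formula k 0 → Set
w ⊨ φ = sem w φ empty 0

_≡w_ : ∀ {k} → Formula k 0 → Formula k 0 → Set
φ ≡w ψ = ∀ w → (w ⊨ φ → w ⊨ ψ) × (w ⊨ ψ → w ⊨ φ)

PolySize : ∀ {k} → (ℕ → Formula k 0) → Set
PolySize φ = Σ ℕ λ c → Σ ℕ λ d → ∀ n → size (φ n) ≤ c * suc n ^ d

{-# OPTIONS --safe #-}
module Submission where

-- Let L = lcm(1, …, 2n+1). The formula μX. (◇⊤ ∧ χ) ∨ ◇X, where χ is the conjunction of
-- νY. □⊥ ∨ ◇ᵃY over 1 ≤ a ≤ 2n+1, holds on every infinite word and on a finite word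
-- exactly when some non-final position lies a multiple of L steps before the end, i.e.
-- when the word has at least L steps; so it is equivalent to ◇ᴸ⊤. An ML formula of size s
-- cannot tell an infinite word from a finite one with s steps, hence every ML equivalent
-- has size at least L. Finally L ≥ (2n+1)·C(2n,n) ≥ 2ⁿ, because (m+1)·C(m,k) divides
-- lcm(1, …, m+1) by induction along Leibniz's harmonic triangle
--   1/((m+1)·C(m,k)) = 1/((m+2)·C(m+1,k)) + 1/((m+2)·C(m+1,k+1)).

open import Data.Bool using (Bool; true; false)
open import Data.Fin using (Fin; zero)
open import Data.Maybe using (just; nothing)
open import Data.Nat
open import Data.Nat.Combinatorics using (_C_; nCk+nC[k+1]≡[n+1]C[k+1]; nC1≡n)
open import Data.Nat.Divisibility
open import Data.Nat.GCD using (gcd)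
open import Data.Nat.Induction using (<-rec)
open import Data.Nat.LCM using (lcm; m∣lcm[m,n]; n∣lcm[m,n]; lcm-least; gcd*lcm)
open import Data.Nat.Properties
open import Data.Nat.Tactic.RingSolver using (solve-∀)
open import Data.Product using (Σ; _×_; _,_; proj₁; proj₂)
open import Data.Product.Function.NonDependent.Propositional using (_×-⇔_)
open import Data.Sum using (inj₁; inj₂)
open import Data.Sum.Function.Propositional using (_⊎-⇔_)
open import Data.Unit using (tt)
open import Function.Bundles using (_⇔_; mk⇔; Equivalence)
open import Function.Construct.Composition using (_⇔-∘_)
open import Function.Construct.Identity using (⇔-id)
open import Function.Construct.Symmetry using (⇔-sym)
open import Relation.Binary.PropositionalEquality
open import Relation.Nullary using (Dec; yes; no; does)
open import Relation.Nullary.Decidable using (dec-true)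

open import Algebra.Properties.CommutativeSemigroup *-commutativeSemigroup using (x∙yz≈y∙xz)

open import Defs

open Equivalence using (to; from)

private
  variable
    n k r : ℕ

nCk>0 : k ≤ n → 0 < n C k
nCk>0 {zero}  _         = z<s
nCk>0 {suc k} (s≤s k≤n) = subst (0 <_) (nCk+nC[k+1]≡[n+1]C[k+1] _ k) (<-≤-trans (nCk>0 k≤n) (m≤m+n _ _))

nCk≤[n+1]Ck : ∀ n k → n C k ≤ suc n C k
nCk≤[n+1]Ck n zero    = ≤-refl
nCk≤[n+1]Ck n (suc k) = subst (n C suc k ≤_) (nCk+nC[k+1]≡[n+1]C[k+1] n k) (m≤n+m _ _)

nCk≤[n+1]C[k+1] : ∀ n k → n C k ≤ suc n C suc k
nCk≤[n+1]C[k+1] n k = subst (n C k ≤_) (nCk+nC[k+1]≡[n+1]C[k+1] n k) (m≤m+n _ _)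

[k+1]*[n+1]C[k+1]≡[n+1]*nCk : ∀ n k → suc k * (suc n C suc k) ≡ suc n * (n C k)
[k+1]*[n+1]C[k+1]≡[n+1]*nCk zero    zero    = refl
[k+1]*[n+1]C[k+1]≡[n+1]*nCk zero    (suc k) = *-zeroʳ (suc (suc k))
[k+1]*[n+1]C[k+1]≡[n+1]*nCk (suc n) zero    = trans (+-identityʳ _) (trans (nC1≡n (suc (suc n))) (sym (*-identityʳ _)))
[k+1]*[n+1]C[k+1]≡[n+1]*nCk (suc n) (suc k) = begin
  suc (suc k) * (suc (suc n) C suc (suc k))   ≡⟨ cong (suc (suc k) *_) (nCk+nC[k+1]≡[n+1]C[k+1] (suc n) (suc k)) ⟨
  suc (suc k) * (x + y)                       ≡⟨ regroup k x y ⟩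
  x + (suc k * x + suc (suc k) * y)           ≡⟨ cong₂ (λ u v → x + (u + v)) ([k+1]*[n+1]C[k+1]≡[n+1]*nCk n k)
                                                                             ([k+1]*[n+1]C[k+1]≡[n+1]*nCk n (suc k)) ⟩
  x + (suc n * (n C k) + suc n * (n C suc k)) ≡⟨ cong (x +_) (*-distribˡ-+ (suc n) (n C k) (n C suc k)) ⟨
  x + suc n * (n C k + n C suc k)             ≡⟨ cong (λ t → x + suc n * t) (nCk+nC[k+1]≡[n+1]C[k+1] n k) ⟩
  suc (suc n) * x                             ∎
  where
  open ≡-Reasoning
  x y : ℕ
  x = suc n C suc k
  y = suc n C suc (suc k)
  regroup : ∀ k x y → suc (suc k) * (x + y) ≡ x + (suc k * x + suc (suc k) * y)
  regroup = solve-∀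

2^n≤[2n]Cn : ∀ n → 2 ^ n ≤ (n + n) C n
2^n≤[2n]Cn zero    = ≤-refl
2^n≤[2n]Cn (suc n) = begin
  2 ^ n + (2 ^ n + 0)                          ≤⟨ +-mono-≤ ih (≤-trans (≤-reflexive (+-identityʳ _)) ih) ⟩
  (n + n) C n + (n + n) C n                    ≤⟨ +-mono-≤ (nCk≤[n+1]Ck (n + n) n) (nCk≤[n+1]C[k+1] (n + n) n) ⟩
  suc (n + n) C n + suc (n + n) C suc n        ≡⟨ nCk+nC[k+1]≡[n+1]C[k+1] (suc (n + n)) n ⟩
  suc (suc (n + n)) C suc n                    ≡⟨ cong (λ t → suc t C suc n) (sym (+-suc n n)) ⟩
  (suc n + suc n) C suc n                      ∎
  where
  open ≤-Reasoning
  ih : 2 ^ n ≤ (n + n) C n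
  ih = 2^n≤[2n]Cn n

-- 1/a = 1/b + 1/c, so r/c = r/a − r/b is a natural number.
∣-harmonic : ∀ {a b c r} .{{_ : NonZero b}} → b * c ≡ a * (b + c) → a ∣ r → b ∣ r → c ∣ r
∣-harmonic {a} {b} {c} {r} bc≡a[b+c] (divides x r≡xa) (divides y r≡yb) =
  ∣m+n∣m⇒∣n (subst (c ∣_) cx≡cy+r (m∣m*n x)) (m∣m*n y)
  where
  open ≡-Reasoning
  cx≡cy+r : c * x ≡ c * y + r
  cx≡cy+r = *-cancelˡ-≡ _ _ b (begin
    b * (c * x)         ≡⟨ *-assoc b c x ⟨
    b * c * x           ≡⟨ cong (_* x) bc≡a[b+c] ⟩
    a * (b + c) * x     ≡⟨ rearrange a (b + c) x ⟩
    (b + c) * (x * a)   ≡⟨ cong ((b + c) *_) r≡xa ⟨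
    (b + c) * r         ≡⟨ *-distribʳ-+ r b c ⟩
    b * r + c * r       ≡⟨ cong (λ t → b * r + c * t) r≡yb ⟩
    b * r + c * (y * b) ≡⟨ collect b r c y ⟩
    b * (c * y + r)     ∎)
    where
    rearrange : ∀ a d x → a * d * x ≡ d * (x * a)
    rearrange = solve-∀
    collect : ∀ b r c y → b * r + c * (y * b) ≡ b * (c * y + r)
    collect = solve-∀

leibniz-harmonic : ∀ n k →
  (suc (suc n) * (suc n C k)) * (suc (suc n) * (suc n C suc k))
    ≡ (suc n * (n C k)) * (suc (suc n) * (suc n C k) + suc (suc n) * (suc n C suc k))
leibniz-harmonic n k = *-cancelˡ-≡ _ _ (suc k) (begin
  suc k * (b * c)         ≡⟨ x∙yz≈y∙xz (suc k) b c ⟩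
  b * (suc k * c)         ≡⟨ cong (b *_) [k+1]c≡[n+2]a ⟩
  b * (suc (suc n) * a)   ≡⟨ x∙yz≈y∙xz b (suc (suc n)) a ⟩
  suc (suc n) * (b * a)   ≡⟨ cong (suc (suc n) *_) (*-comm b a) ⟩
  suc (suc n) * (a * b)   ≡⟨ x∙yz≈y∙xz (suc (suc n)) a b ⟩
  a * (suc (suc n) * b)   ≡⟨ cong (a *_) [k+1][b+c]≡[n+2]b ⟨
  a * (suc k * (b + c))   ≡⟨ x∙yz≈y∙xz a (suc k) (b + c) ⟩
  suc k * (a * (b + c))   ∎)
  where
  open ≡-Reasoning
  a b c : ℕ
  a = suc n * (n C k)
  b = suc (suc n) * (suc n C k)
  c = suc (suc n) * (suc n C suc k)
  [k+1]c≡[n+2]a : suc k * c ≡ suc (suc n) * a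
  [k+1]c≡[n+2]a = trans (x∙yz≈y∙xz (suc k) (suc (suc n)) (suc n C suc k))
                        (cong (suc (suc n) *_) ([k+1]*[n+1]C[k+1]≡[n+1]*nCk n k))
  [k+1][b+c]≡[n+2]b : suc k * (b + c) ≡ suc (suc n) * b
  [k+1][b+c]≡[n+2]b = begin
    suc k * (b + c)
      ≡⟨ cong (suc k *_) (*-distribˡ-+ (suc (suc n)) (suc n C k) (suc n C suc k)) ⟨
    suc k * (suc (suc n) * (suc n C k + suc n C suc k))
      ≡⟨ cong (λ t → suc k * (suc (suc n) * t)) (nCk+nC[k+1]≡[n+1]C[k+1] (suc n) k) ⟩
    suc k * (suc (suc n) * (suc (suc n) C suc k))
      ≡⟨ x∙yz≈y∙xz (suc k) (suc (suc n)) (suc (suc n) C suc k) ⟩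
    suc (suc n) * (suc k * (suc (suc n) C suc k))
      ≡⟨ cong (suc (suc n) *_) ([k+1]*[n+1]C[k+1]≡[n+1]*nCk (suc n) k) ⟩
    suc (suc n) * b
      ∎

lcmUpTo : ℕ → ℕ
lcmUpTo zero    = 1
lcmUpTo (suc M) = lcm (suc M) (lcmUpTo M)

lcmUpTo[1+M]∣⇔ : ∀ M → (suc M ∣ r × lcmUpTo M ∣ r) ⇔ lcmUpTo (suc M) ∣ r
lcmUpTo[1+M]∣⇔ M = mk⇔ (λ (M+1∣r , L∣r) → lcm-least M+1∣r L∣r)
  (λ L∣r → ∣-trans (m∣lcm[m,n] (suc M) (lcmUpTo M)) L∣r , ∣-trans (n∣lcm[m,n] (suc M) (lcmUpTo M)) L∣r)

lcmUpTo[n+1]∣⇒[n+1]*nCk∣ : ∀ n k → k ≤ n → lcmUpTo (suc n) ∣ r → suc n * (n C k) ∣ r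
lcmUpTo[n+1]∣⇒[n+1]*nCk∣ {r} n zero _ L∣r =
  subst (_∣ r) (sym (*-identityʳ (suc n))) (proj₁ (from (lcmUpTo[1+M]∣⇔ n) L∣r))
lcmUpTo[n+1]∣⇒[n+1]*nCk∣ (suc n) (suc k) (s≤s k≤n) L∣r =
  ∣-harmonic {{b≢0}} (leibniz-harmonic n k)
    (lcmUpTo[n+1]∣⇒[n+1]*nCk∣ n k k≤n (proj₂ (from (lcmUpTo[1+M]∣⇔ (suc n)) L∣r)))
    (lcmUpTo[n+1]∣⇒[n+1]*nCk∣ (suc n) k (m≤n⇒m≤1+n k≤n) L∣r)
  where
  b≢0 : NonZero (suc (suc n) * (suc n C k))
  b≢0 = m*n≢0 (suc (suc n)) (suc n C k) {{_}} {{>-nonZero (nCk>0 (m≤n⇒m≤1+n k≤n))}}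

lcm-nonZero : ∀ m n .{{_ : NonZero m}} .{{_ : NonZero n}} → NonZero (lcm m n)
lcm-nonZero m n = m*n≢0⇒n≢0 (gcd m n) {{subst NonZero (sym (gcd*lcm m n)) (m*n≢0 m n)}}

lcmUpTo-nonZero : ∀ M → NonZero (lcmUpTo M)
lcmUpTo-nonZero zero    = _
lcmUpTo-nonZero (suc M) = lcm-nonZero (suc M) (lcmUpTo M) {{_}} {{lcmUpTo-nonZero M}}

2^n≤lcmUpTo[2n+1] : ∀ n → 2 ^ n ≤ lcmUpTo (suc (n + n))
2^n≤lcmUpTo[2n+1] n = begin
  2 ^ n                          ≤⟨ 2^n≤[2n]Cn n ⟩
  (n + n) C n                    ≤⟨ m≤n*m _ (suc (n + n)) ⟩
  suc (n + n) * ((n + n) C n)    ≤⟨ ∣⇒≤ {{lcmUpTo-nonZero (suc (n + n))}}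
                                        (lcmUpTo[n+1]∣⇒[n+1]*nCk∣ (n + n) n (m≤n+m n n) ∣-refl) ⟩
  lcmUpTo (suc (n + n))          ∎
  where open ≤-Reasoning

Labels : ℕ → Set
Labels k = ℕ → Fin k → Bool

decidedSet : {P : Pred} → (∀ j → Dec (P j)) → ℕ → Bool
decidedSet P? j = does (P? j)

∈decidedSet⇔ : {P : Pred} (P? : ∀ j → Dec (P j)) (j : ℕ) → asPred (decidedSet P?) j ⇔ P j
∈decidedSet⇔ {P} P? j = mk⇔ fromDoes (dec-true (P? j))
  where
  fromDoes : does (P? j) ≡ true → P j
  fromDoes with P? j
  ... | yes p = λ _ → p
  ... | no _  = λ ()

m∸[n+i]≡m∸i∸n : ∀ m n i → m ∸ (n + i) ≡ m ∸ i ∸ n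
m∸[n+i]≡m∸i∸n m n i = trans (cong (m ∸_) (+-comm n i)) (sym (∸-+-assoc m i n))

i+[1+x+y]≤m⇒i+x≤m : ∀ i x y {m} → i + suc (x + y) ≤ m → i + x ≤ m
i+[1+x+y]≤m⇒i+x≤m i x y = ≤-trans (+-monoʳ-≤ i (m≤n⇒m≤1+n (m≤m+n x y)))

i+[1+x+y]≤m⇒i+y≤m : ∀ i x y {m} → i + suc (x + y) ≤ m → i + y ≤ m
i+[1+x+y]≤m⇒i+y≤m i x y = ≤-trans (+-monoʳ-≤ i (m≤n⇒m≤1+n (m≤n+m y x)))

i+[1+x]≤m⇒1+i+x≤m : ∀ i x {m} → i + suc x ≤ m → suc i + x ≤ m
i+[1+x]≤m⇒1+i+x≤m i x {m} = subst (_≤ m) (+-suc i x)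

module _ {k : ℕ} where

  finiteWord : ℕ → Labels k → Word k
  finiteWord m f = record { len = just m ; label = f }

  infiniteWord : Labels k → Word k
  infiniteWord f = record { len = nothing ; label = f }

  ≡w-byCases : {φ ψ : Formula k 0} →
               (∀ m f → finiteWord m f ⊨ φ ⇔ finiteWord m f ⊨ ψ) →
               (∀ f → infiniteWord f ⊨ φ ⇔ infiniteWord f ⊨ ψ) → φ ≡w ψ
  ≡w-byCases fin inf record { len = just m  ; label = f } = to (fin m f) , from (fin m f)
  ≡w-byCases fin inf record { len = nothing ; label = f } = to (inf f) , from (inf f)

  module _ {n : ℕ} {ρ : Fin n → Pred} {f : Labels k} where

    ML-finite⇔infinite : ∀ {ψ : Formula k n} → IsML ψ → ∀ {m i} → i + size ψ ≤ m →
                         sem (finiteWord m f) ψ ρ i ⇔ sem (infiniteWord f) ψ ρ i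
    ML-finite⇔infinite tt        _ = ⇔-id _
    ML-finite⇔infinite ff        _ = ⇔-id _
    ML-finite⇔infinite (prop p)  _ = ⇔-id _
    ML-finite⇔infinite (nprop p) _ = ⇔-id _
    ML-finite⇔infinite (_∧_ {φ} {ψ} ml₁ ml₂) {i = i} le =
      ML-finite⇔infinite ml₁ (i+[1+x+y]≤m⇒i+x≤m i (size φ) (size ψ) le)
        ×-⇔ ML-finite⇔infinite ml₂ (i+[1+x+y]≤m⇒i+y≤m i (size φ) (size ψ) le)
    ML-finite⇔infinite (_∨_ {φ} {ψ} ml₁ ml₂) {i = i} le =
      ML-finite⇔infinite ml₁ (i+[1+x+y]≤m⇒i+x≤m i (size φ) (size ψ) le)
        ⊎-⇔ ML-finite⇔infinite ml₂ (i+[1+x+y]≤m⇒i+y≤m i (size φ) (size ψ) le)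
    ML-finite⇔infinite (◇ {φ} ml) {m} {i} le = mk⇔
      (λ (_ , s) → tt , to ih s)
      (λ (_ , s) → m+n≤o⇒m≤o (suc i) le′ , from ih s)
      where
      le′ : suc i + size φ ≤ m
      le′ = i+[1+x]≤m⇒1+i+x≤m i (size φ) le
      ih : sem (finiteWord m f) φ ρ (suc i) ⇔ sem (infiniteWord f) φ ρ (suc i)
      ih = ML-finite⇔infinite ml le′
    ML-finite⇔infinite (□ {φ} ml) {m} {i} le = mk⇔
      (λ s _ → to ih (s (m+n≤o⇒m≤o (suc i) le′)))
      (λ s _ → from ih (s tt))
      where
      le′ : suc i + size φ ≤ m
      le′ = i+[1+x]≤m⇒1+i+x≤m i (size φ) le
      ih : sem (finiteWord m f) φ ρ (suc i) ⇔ sem (infiniteWord f) φ ρ (suc i)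
      ih = ML-finite⇔infinite ml le′

  lengthThreshold≤size : ∀ (φ : Formula k 0) {ψ : Formula k 0} {L} →
    (∀ m f → finiteWord m f ⊨ φ → L ≤ m) → (∀ f → infiniteWord f ⊨ φ) →
    IsML ψ → φ ≡w ψ → L ≤ size ψ
  lengthThreshold≤size φ {ψ} finite⇒L≤m infinite ml φ≡ψ =
    finite⇒L≤m (size ψ) f (proj₂ (φ≡ψ (finiteWord (size ψ) f))
      (from (ML-finite⇔infinite ml ≤-refl) (proj₁ (φ≡ψ (infiniteWord f)) (infinite f))))
    where
    f : Labels k
    f _ _ = false

  ◇^ : ∀ {n} → ℕ → Formula k n → Formula k n
  ◇^ zero    φ = φ
  ◇^ (suc a) φ = ◇ (◇^ a φ)

  IsML-◇^ : ∀ {n} a {φ : Formula k n} → IsML φ → IsML (◇^ a φ)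
  IsML-◇^ zero    ml = ml
  IsML-◇^ (suc a) ml = ◇ (IsML-◇^ a ml)

  size-◇^ : ∀ {n} a (φ : Formula k n) → size (◇^ a φ) ≡ a + size φ
  size-◇^ zero    φ = refl
  size-◇^ (suc a) φ = cong suc (size-◇^ a φ)

  remainingDivisibleBy : ∀ {n} → ℕ → Formula k n
  remainingDivisibleBy a = ν (□ ff ∨ ◇^ a (var zero))

  remainingCommonMultipleUpTo : ∀ {n} → ℕ → Formula k n
  remainingCommonMultipleUpTo zero    = tt
  remainingCommonMultipleUpTo (suc M) = remainingDivisibleBy (suc M) ∧ remainingCommonMultipleUpTo M

  reachesLcmUpTo : ℕ → Formula k 0
  reachesLcmUpTo M = μ ((◇ tt ∧ remainingCommonMultipleUpTo M) ∨ ◇ (var zero))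

  module _ {n : ℕ} {ρ : Fin n → Pred} {f : Labels k} where

    ◇^-finite : ∀ {m} {φ : Formula k n} a {i} →
                sem (finiteWord m f) (◇^ (suc a) φ) ρ i ⇔ (suc a + i ≤ m × sem (finiteWord m f) φ ρ (suc a + i))
    ◇^-finite zero = ⇔-id _
    ◇^-finite (suc a) {i} rewrite sym (+-suc (suc a) i) = mk⇔
      (λ (_ , s) → to (◇^-finite a) s)
      (λ (le , s) → ≤-trans (m≤n+m (suc i) (suc a)) le , from (◇^-finite a) (le , s))

    ◇^-infinite : ∀ {φ : Formula k n} a {i} → sem (infiniteWord f) (◇^ a φ) ρ i ⇔ sem (infiniteWord f) φ ρ (a + i)
    ◇^-infinite zero = ⇔-id _
    ◇^-infinite (suc a) {i} rewrite sym (+-suc a i) = mk⇔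
      (λ (_ , s) → to (◇^-infinite a) s)
      (λ s → tt , from (◇^-infinite a) s)

  module _ {n : ℕ} {ρ : Fin n → Pred} {f : Labels k} where

    -- No bound i ≤ m is needed: beyond the end, m ∸ i = 0 and □⊥ holds.
    remainingDivisibleBy-finite : ∀ {m} a {i} → sem (finiteWord m f) (remainingDivisibleBy (suc a)) ρ i ⇔ suc a ∣ m ∸ i
    remainingDivisibleBy-finite {m} a = mk⇔ sound complete
      where
      w : Word k
      w = finiteWord m f

      sound : ∀ {i} → sem w (remainingDivisibleBy (suc a)) ρ i → suc a ∣ m ∸ i
      sound {i} (X , post , Xi) = <-rec _ step (m ∸ i) refl Xi
        where
        step : ∀ d → (∀ {d′} → d′ < d → ∀ {j} → m ∸ j ≡ d′ → asPred X j → suc a ∣ d′) →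
               ∀ {j} → m ∸ j ≡ d → asPred X j → suc a ∣ d
        step d rec {j} refl Xj with post j Xj
        ... | inj₁ final = subst (suc a ∣_) (sym (m≤n⇒m∸n≡0 (≮⇒≥ final))) (suc a ∣0)
        ... | inj₂ next with to (◇^-finite a) next
        ... | le , Xj′ = ∣m∸n∣n⇒∣m (suc a) a+1≤d
                           (rec (∸-monoʳ-< {o = 0} z<s a+1≤d) (m∸[n+i]≡m∸i∸n m (suc a) j) Xj′) ∣-refl
          where
          a+1≤d : suc a ≤ m ∸ j
          a+1≤d = m+n≤o⇒m≤o∸n (suc a) le

      P? : ∀ j → Dec (suc a ∣ m ∸ j)
      P? j = suc a ∣? m ∸ j

      complete : ∀ {i} → suc a ∣ m ∸ i → sem w (remainingDivisibleBy (suc a)) ρ i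
      complete {i} a+1∣m-i = decidedSet P? , post , from (∈decidedSet⇔ P? i) a+1∣m-i
        where
        post : ∀ j → asPred (decidedSet P?) j →
               sem w (□ ff ∨ ◇^ (suc a) (var zero)) (extend ρ (asPred (decidedSet P?))) j
        post j Xj with m ≤? j
        ... | yes m≤j = inj₁ (λ j<m → <⇒≱ j<m m≤j)
        ... | no  m≰j = inj₂ (from (◇^-finite a) (le , from (∈decidedSet⇔ P? (suc a + j)) a+1∣d′))
          where
          a+1∣d : suc a ∣ m ∸ j
          a+1∣d = to (∈decidedSet⇔ P? j) Xj
          a+1≤d : suc a ≤ m ∸ j
          a+1≤d = ∣⇒≤ {{>-nonZero (m<n⇒0<n∸m (≰⇒> m≰j))}} a+1∣d
          le : suc a + j ≤ m
          le = m≤o∸n⇒m+n≤o (suc a) (<⇒≤ (≰⇒> m≰j)) a+1≤d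
          a+1∣d′ : suc a ∣ m ∸ (suc a + j)
          a+1∣d′ = subst (suc a ∣_) (sym (m∸[n+i]≡m∸i∸n m (suc a) j))
                     (∣m+n∣m⇒∣n (subst (suc a ∣_) (sym (m+[n∸m]≡n a+1≤d)) a+1∣d) ∣-refl)

    remainingDivisibleBy-infinite : ∀ a {i} → sem (infiniteWord f) (remainingDivisibleBy a) ρ i
    remainingDivisibleBy-infinite a = (λ _ → true) , (λ j _ → inj₂ (from (◇^-infinite a) refl)) , refl

    remainingCommonMultipleUpTo-finite : ∀ {m} M {i} →
      sem (finiteWord m f) (remainingCommonMultipleUpTo M) ρ i ⇔ lcmUpTo M ∣ m ∸ i
    remainingCommonMultipleUpTo-finite zero    = mk⇔ (λ _ → 1∣ _) (λ _ → tt)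
    remainingCommonMultipleUpTo-finite (suc M) =
      lcmUpTo[1+M]∣⇔ M ⇔-∘ (remainingDivisibleBy-finite M ×-⇔ remainingCommonMultipleUpTo-finite M)

    remainingCommonMultipleUpTo-infinite : ∀ M {i} → sem (infiniteWord f) (remainingCommonMultipleUpTo M) ρ i
    remainingCommonMultipleUpTo-infinite zero    = tt
    remainingCommonMultipleUpTo-infinite (suc M) =
      remainingDivisibleBy-infinite (suc M) , remainingCommonMultipleUpTo-infinite M

  module _ {f : Labels k} where

    reachesLcmUpTo-finite : ∀ {m} M → finiteWord m f ⊨ reachesLcmUpTo M ⇔ lcmUpTo M ≤ m
    reachesLcmUpTo-finite {m} M = mk⇔ sound complete
      where
      w : Word k
      w = finiteWord m f
      L : ℕ
      L = lcmUpTo M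
      body : Formula k 1
      body = (◇ tt ∧ remainingCommonMultipleUpTo M) ∨ ◇ (var zero)

      sound : w ⊨ reachesLcmUpTo M → L ≤ m
      sound s = subst (_≤ m) (+-identityʳ L) (to (∈decidedSet⇔ P? 0) (s (decidedSet P?) pre))
        where
        P? : ∀ j → Dec (L + j ≤ m)
        P? j = L + j ≤? m
        pre : ∀ j → sem w body (extend empty (asPred (decidedSet P?))) j → asPred (decidedSet P?) j
        pre j (inj₁ ((j<m , _) , cm)) = from (∈decidedSet⇔ P? j) (m≤o∸n⇒m+n≤o L (<⇒≤ j<m)
          (∣⇒≤ {{>-nonZero (m<n⇒0<n∸m j<m)}} (to (remainingCommonMultipleUpTo-finite M) cm)))
        pre j (inj₂ (_ , Xj+1)) = from (∈decidedSet⇔ P? j)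
          (≤-trans (+-monoʳ-≤ L (n≤1+n j)) (to (∈decidedSet⇔ P? (suc j)) Xj+1))

      complete : L ≤ m → w ⊨ reachesLcmUpTo M
      complete L≤m Y pre = backwards (m ∸ L) (m∸n≤m m L) (pre (m ∸ L) (inj₁ ((start<m , tt) , cm)))
        where
        start<m : m ∸ L < m
        start<m = ∸-monoʳ-< {o = 0} (>-nonZero⁻¹ L {{lcmUpTo-nonZero M}}) L≤m
        cm : sem w (remainingCommonMultipleUpTo M) (extend empty (asPred Y)) (m ∸ L)
        cm = from (remainingCommonMultipleUpTo-finite M) (subst (L ∣_) (sym (m∸[m∸n]≡n L≤m)) ∣-refl)
        backwards : ∀ j → j ≤ m → asPred Y j → asPred Y 0
        backwards zero    _     Y0   = Y0
        backwards (suc j) j+1≤m Yj+1 = backwards j (<⇒≤ j+1≤m) (pre j (inj₂ (j+1≤m , Yj+1)))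

    reachesLcmUpTo-infinite : ∀ M → infiniteWord f ⊨ reachesLcmUpTo M
    reachesLcmUpTo-infinite M Y pre = pre 0 (inj₁ ((tt , tt) , remainingCommonMultipleUpTo-infinite M))

    ◇^tt-finite : ∀ {m} L → finiteWord m f ⊨ ◇^ L tt ⇔ L ≤ m
    ◇^tt-finite zero        = mk⇔ (λ _ → z≤n) (λ _ → tt)
    ◇^tt-finite {m} (suc L) = mk⇔
      (λ s → subst (_≤ m) (+-identityʳ (suc L)) (proj₁ (to (◇^-finite L) s)))
      (λ le → from (◇^-finite L) (subst (_≤ m) (sym (+-identityʳ (suc L))) le , tt))

    ◇^tt-infinite : ∀ L → infiniteWord f ⊨ ◇^ L tt
    ◇^tt-infinite L = from (◇^-infinite L) tt

  reachesLcmUpTo≡w◇^lcmUpTo : ∀ M → reachesLcmUpTo M ≡w ◇^ (lcmUpTo M) tt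
  reachesLcmUpTo≡w◇^lcmUpTo M = ≡w-byCases {reachesLcmUpTo M} {◇^ (lcmUpTo M) tt}
    (λ m f → ⇔-sym (◇^tt-finite {f} {m} (lcmUpTo M)) ⇔-∘ reachesLcmUpTo-finite {f} {m} M)
    (λ f → mk⇔ (λ _ → ◇^tt-infinite {f} (lcmUpTo M)) (λ _ → reachesLcmUpTo-infinite {f} M))

  lcmUpTo≤size : ∀ M {ψ : Formula k 0} → IsML ψ → reachesLcmUpTo M ≡w ψ → lcmUpTo M ≤ size ψ
  lcmUpTo≤size M = lengthThreshold≤size (reachesLcmUpTo M)
    (λ m f → to (reachesLcmUpTo-finite {f} {m} M)) (λ f → reachesLcmUpTo-infinite {f} M)

  size-remainingDivisibleBy : ∀ {n} a → size (remainingDivisibleBy {n} a) ≡ a + 5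
  size-remainingDivisibleBy {n} a rewrite size-◇^ a (var {k} {suc n} zero) = shift a
    where
    shift : ∀ a → 4 + (a + 1) ≡ a + 5
    shift = solve-∀

  size-remainingCommonMultipleUpTo : ∀ {n} M → size (remainingCommonMultipleUpTo {n} M) ≤ (M + 4) * (M + 4)
  size-remainingCommonMultipleUpTo zero    = s≤s z≤n
  size-remainingCommonMultipleUpTo {n} (suc M) = begin
    suc (size (remainingDivisibleBy {n} (suc M)) + size (remainingCommonMultipleUpTo {n} M))
      ≡⟨ cong (λ t → suc (t + size (remainingCommonMultipleUpTo {n} M))) (size-remainingDivisibleBy (suc M)) ⟩
    suc (suc M + 5 + size (remainingCommonMultipleUpTo {n} M))
      ≤⟨ s≤s (+-monoʳ-≤ (suc M + 5) (size-remainingCommonMultipleUpTo M)) ⟩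
    suc (suc M + 5 + (M + 4) * (M + 4))
      ≤⟨ m≤m+n _ (M + 2) ⟩
    suc (suc M + 5 + (M + 4) * (M + 4)) + (M + 2)
      ≡⟨ square M ⟩
    (suc M + 4) * (suc M + 4) ∎
    where
    open ≤-Reasoning
    square : ∀ M → suc (suc M + 5 + (M + 4) * (M + 4)) + (M + 2) ≡ (suc M + 4) * (suc M + 4)
    square = solve-∀

  size-reachesLcmUpTo[2n+1] : ∀ n → size (reachesLcmUpTo (suc (n + n))) ≤ 32 * suc n ^ 2
  size-reachesLcmUpTo[2n+1] n = begin
    size (reachesLcmUpTo (suc (n + n)))        ≡⟨ wrapper (size body) ⟩
    7 + size body                              ≤⟨ +-monoʳ-≤ 7 (size-remainingCommonMultipleUpTo (suc (n + n))) ⟩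
    7 + (suc (n + n) + 4) * (suc (n + n) + 4)  ≤⟨ m≤m+n _ (28 * n * n + 44 * n) ⟩
    7 + (suc (n + n) + 4) * (suc (n + n) + 4) + (28 * n * n + 44 * n) ≡⟨ square n ⟩
    32 * suc n ^ 2                             ∎
    where
    open ≤-Reasoning
    body : Formula k 1
    body = remainingCommonMultipleUpTo (suc (n + n))
    wrapper : ∀ s → suc (suc (suc (suc (suc s)) + 2)) ≡ 7 + s
    wrapper = solve-∀
    square : ∀ n → 7 + (suc (n + n) + 4) * (suc (n + n) + 4) + (28 * n * n + 44 * n) ≡ 32 * (suc n * (suc n * 1))
    square = solve-∀

proposition4 : (k : ℕ) → Σ (ℕ → Formula k 0) λ φ → PolySize φ × (∀ n → Σ (Formula k 0) (λ ψ → IsML ψ × (φ n ≡w ψ)) × (∀ (ψ : Formula k 0) → IsML ψ → φ n ≡w ψ → 2 ^ n ≤ size ψ))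
proposition4 k = φ , (32 , 2 , size-reachesLcmUpTo[2n+1]) , λ n →
  (◇^ (lcmUpTo (M n)) tt , IsML-◇^ (lcmUpTo (M n)) tt , reachesLcmUpTo≡w◇^lcmUpTo (M n)) ,
  λ ψ ml φ≡ψ → ≤-trans (2^n≤lcmUpTo[2n+1] n) (lcmUpTo≤size (M n) ml φ≡ψ)
  where
  M : ℕ → ℕ
  M n = suc (n + n)
  φ : ℕ → Formula k 0
  φ n = reachesLcmUpTo (M n)
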